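{- (i) If $x$ solves $(PP)$, then $\lambda=\mathrm{sgn}(A_{\pi_1}x)$ solves $(DP)$. (ii) If $\lambda$ solves $(DP)$, then $x=\frac{1}{2}\bigl(A_{\pi_1}^T\lambda+(n+1)\mathbf{1}_{n^2}\bigr)$ solves $(PP)$.
   Context: Let $n\ge 2$ be an integer and $s(m)=\sum_{i=1}^{m-1} i$. Define matrices $A(m)$ with $s(m)$ rows and $m$ columns recursively: $A(1)$ is the empty matrix, and for $m\ge 2$, $A(m)=\begin{pmatrix}\mathbf{1}_{m-1} & -U_{m-1}\\ \mathbf{0}_{s(m-1)} & A(m-1)\end{pmatrix}$, where $\mathbf{1}_{m-1}$ is the column vector of $m-1$ ones, $U_{m-1}$ is the identity matrix and $\mathbf{0}_{s(m-1)}$ is the zero column vector of length $s(m-1)$. Let $A$ be the $n\,s(n)\times n^2$ block-diagonal matrix with $n$ copies of $A(n)$ on its diagonal and zeros elsewhere. For a permutation $\pi$ of $\{1,\dots,n^2\}$ let $A_\pi=(a^{\pi^{ -1}(1)},\dots,a^{\pi^{ -1}(n^2)})$, where $a^j$ is the $j$-th column of $A$. For $y\in\mathbb{Z}^s$ write $y<>\mathbf{0}$ if every component of $y$ is nonzero; for such $y$, $\mathrm{sgn}(y)$ is the componentwise sign vector. $\mathbf 1_m$ is the vector of $m$ ones. Fix permutations $\pi_1,\pi_2,\pi_3$ of $\{1,\dots,n^2\}$, an integer $0\le k\le n^2$, an index set $\{i_1,\dots,i_k\}\subset\{1,\dots,n^2\}$ and integers $g_{i_1},\dots,g_{i_k}$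 with $1\le g_{i_l}\le n$. Let $g=(g_{i_1},\dots,g_{i_k})^T$ and let $A_{eq}$ be the $k\times n^2$ matrix whose $l$-th row is the $i_l$-th row of the $n^2\times n^2$ identity matrix, so $[A_{eq}x]_l=x_{i_l}$. $x$ solves the primal problem $(PP)$ if $x=(x_1,\dots,x_{n^2})^T\in\mathbb{Z}^{n^2}$, $1\le x_i\le n$ for all $i$, $A_{\pi_r}x<>\mathbf{0}$ for $r=1,2,3$, and $A_{eq}x=g$. $\lambda$ solves the dual problem $(DP)$ if $\lambda\in\{ -1,+1\}^{n\cdot s(n)}$, $A_{\pi_r}A_{\pi_1}^T\lambda<>\mathbf{0}$ for $r=1,2,3$, and $A_{eq}A_{\pi_1}^T\lambda=2g-(n+1)\mathbf{1}_k$. -}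

module Defs where

open import Data.Nat as ℕ using (ℕ; zero; suc)
open import Data.Integer as ℤ using (ℤ; +_; -[1+_]; -_; _+_; _*_; _≤_)
open import Data.Fin as Fin using (Fin; zero; suc; splitAt; remQuot; _≟_)
open import Data.Fin.Permutation using (Permutation′; _⟨$⟩ˡ_)
open import Data.Sum using (_⊎_; inj₁; inj₂)
open import Data.Product using (_×_; _,_; ∃)
open import Relation.Nullary using (¬_; yes; no)
open import Relation.Binary.PropositionalEquality using (_≡_; _≢_)
open import Function.Definitions using (Injective)

Vecℤ : ℕ → Set
Vecℤ m = Fin m → ℤ

Matℤ : ℕ → ℕ → Set
Matℤ r c = Fin r → Fin c → ℤ

Σℤ : ∀ {m} → Vecℤ m → ℤ
Σℤ {zero}  v = + 0
Σℤ {suc m} v = v zero + Σℤ (λ i → v (suc i))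

_·_ : ∀ {r c} → Matℤ r c → Vecℤ c → Vecℤ r
(M · v) i = Σℤ (λ j → M i j * v j)

_ᵀ : ∀ {r c} → Matℤ r c → Matℤ c r
(M ᵀ) j i = M i j

s : ℕ → ℕ
s zero    = 0
s (suc m) = m ℕ.+ s m

δ : ∀ {m} → Fin m → Fin m → ℤ
δ i j with i ≟ j
... | yes _ = + 1
... | no  _ = + 0

-- A(m) : s(m) × m, defined recursively:
-- A(m+1) = ( 1_m  | -U_m ; 0_{s(m)} | A(m) )
Am : (m : ℕ) → Matℤ (s m) m
Am zero    ()
Am (suc m) r c with splitAt m r
Am (suc m) r zero    | inj₁ i = + 1
Am (suc m) r (suc j) | inj₁ i = - δ i j
Am (suc m) r zero    | inj₂ r' = + 0
Am (suc m) r (suc j) | inj₂ r' = Am m r' j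

-- block-diagonal matrix with n copies of A(n): (n·s(n)) × (n·n)
blockA : (n : ℕ) → Matℤ (n ℕ.* s n) (n ℕ.* n)
blockA n r c with remQuot {n} (s n) r | remQuot {n} n c
... | (b , i) | (b' , j) with b ≟ b'
...   | yes _ = Am n i j
...   | no  _ = + 0

-- A_π = (a^{π⁻¹(1)}, …, a^{π⁻¹(n²)}): column j of A_π is column π⁻¹(j) of A
Aπ : (n : ℕ) → Permutation′ (n ℕ.* n) → Matℤ (n ℕ.* s n) (n ℕ.* n)
Aπ n π r j = blockA n r (π ⟨$⟩ˡ j)

_<>0 : ∀ {m} → Vecℤ m → Set
y <>0 = ∀ i → y i ≢ + 0

sgnℤ : ℤ → ℤ
sgnℤ (+ zero)  = + 0
sgnℤ (+ suc _) = + 1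
sgnℤ -[1+ _ ]  = -[1+ 0 ]

sgn : ∀ {m} → Vecℤ m → Vecℤ m
sgn y i = sgnℤ (y i)

-- Primal problem (PP): x ∈ ℤ^{n²}, 1 ≤ x_i ≤ n, A_{π_r} x <> 0 (r=1,2,3), A_eq x = g,
-- where the index set {i_1,…,i_k} is given by an injective ι : Fin k → Fin (n²)
PP : (n : ℕ) (π₁ π₂ π₃ : Permutation′ (n ℕ.* n)) (k : ℕ)
     (ι : Fin k → Fin (n ℕ.* n)) (g : Vecℤ k) → Vecℤ (n ℕ.* n) → Set
PP n π₁ π₂ π₃ k ι g x =
  (∀ i → (+ 1 ≤ x i) × (x i ≤ + n)) ×
  (Aπ n π₁ · x) <>0 × (Aπ n π₂ · x) <>0 × (Aπ n π₃ · x) <>0 ×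
  (∀ l → x (ι l) ≡ g l)

DP : (n : ℕ) (π₁ π₂ π₃ : Permutation′ (n ℕ.* n)) (k : ℕ)
     (ι : Fin k → Fin (n ℕ.* n)) (g : Vecℤ k) → Vecℤ (n ℕ.* s n) → Set
DP n π₁ π₂ π₃ k ι g lam =
  (∀ i → lam i ≡ + 1 ⊎ lam i ≡ -[1+ 0 ]) ×
  (Aπ n π₁ · ((Aπ n π₁ ᵀ) · lam)) <>0 ×
  (Aπ n π₂ · ((Aπ n π₁ ᵀ) · lam)) <>0 ×
  (Aπ n π₃ · ((Aπ n π₁ ᵀ) · lam)) <>0 ×
  (∀ l → ((Aπ n π₁ ᵀ) · lam) (ι l) ≡ (+ 2 * g l) ℤ.- (+ (suc n)))

-- In each of the n diagonal blocks, the row of A(n) indexed by a pair i < k maps z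
-- to z_i − z_k.  Every row of A_π sums to zero, so 2x = A_{π₁}ᵀλ + (n+1)𝟏 gives
-- 2 A_π x = A_π A_{π₁}ᵀ λ, and the nonvanishing conditions of (PP) and (DP) match.
-- (i) A_{π₁} x <> 0 makes the entries of each block of x distinct, hence a
-- permutation of 1,…,n, and the corresponding column of A(n)ᵀ sgn(A(n) z) is
-- Σ_k sgn(z_j − z_k) = (z_j − 1) − (n − z_j) = 2 z_j − (n+1).
-- (ii) A column of A(n)ᵀ has n − 1 entries ±1 and otherwise zeros, so against
-- λ ∈ {±1} its value plus n + 1 is an even number between 2 and 2n.

module Submission where

open import Defs
open import Data.Nat as ℕ using (ℕ; zero; suc; _≥_; z≤n; s≤s)
import Data.Nat.Properties as ℕP
open import Data.Integer as ℤ using (ℤ; +_; -[1+_]; -_; _+_; _*_; _-_; _≤_; _⊖_; +≤+)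
import Data.Integer.Properties as ℤP
open import Data.Integer.Tactic.RingSolver using (solve-∀)
open import Data.Fin as Fin
  using (Fin; zero; suc; splitAt; join; combine; remQuot; quotRem; _↑ˡ_; _↑ʳ_; toℕ; _≟_)
import Data.Fin.Properties as FinP
open import Data.Fin.Permutation
  using (Permutation′; permutation; _⟨$⟩ʳ_; _⟨$⟩ˡ_; inverseˡ; inverseʳ; flip)
open import Data.Sum using (_⊎_; inj₁; inj₂; [_,_]′)
open import Data.Product using (_×_; _,_; ∃; proj₁; proj₂; swap; uncurry)
open import Data.Empty using (⊥-elim)
open import Relation.Nullary using (yes; no)
open import Relation.Binary.PropositionalEquality
open ≡-Reasoning
open import Function.Base using (_∘_)
open import Function.Definitions using (Injective)
open import Algebra.Properties.CommutativeMonoid.Sum ℤP.+-0-commutativeMonoid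
  using (sum; sum-cong-≗; sum-permute; ∑-distrib-+; sum-replicate-zero)
open import Algebra.Properties.Semiring.Sum ℤP.+-*-semiring using (*-distribʳ-sum)

Σℤ≡sum : ∀ {m} (f : Vecℤ m) → Σℤ f ≡ sum f
Σℤ≡sum {zero}  f = refl
Σℤ≡sum {suc m} f = cong (_+_ (f zero)) (Σℤ≡sum (f ∘ suc))

Σℤ-via-sum : ∀ {m} (f g : Vecℤ m) → sum f ≡ sum g → Σℤ f ≡ Σℤ g
Σℤ-via-sum f g e = trans (Σℤ≡sum f) (trans e (sym (Σℤ≡sum g)))

Σℤ-cong : ∀ {m} {f g : Vecℤ m} → (∀ i → f i ≡ g i) → Σℤ f ≡ Σℤ g
Σℤ-cong {f = f} {g} e = Σℤ-via-sum f g (sum-cong-≗ e)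

Σℤ-permute : ∀ {m} (f : Vecℤ m) (π : Permutation′ m) → Σℤ (f ∘ (π ⟨$⟩ʳ_)) ≡ Σℤ f
Σℤ-permute f π = Σℤ-via-sum _ f (sym (sum-permute f π))

Σℤ-distrib-+ : ∀ {m} (f g : Vecℤ m) → Σℤ (λ i → f i + g i) ≡ Σℤ f + Σℤ g
Σℤ-distrib-+ f g = trans (Σℤ≡sum (λ i → f i + g i))
  (trans (∑-distrib-+ f g) (sym (cong₂ _+_ (Σℤ≡sum f) (Σℤ≡sum g))))

Σℤ-distribʳ-* : ∀ {m} (f : Vecℤ m) c → Σℤ f * c ≡ Σℤ (λ i → f i * c)
Σℤ-distribʳ-* f c = trans (cong (_* c) (Σℤ≡sum f))
  (trans (*-distribʳ-sum c f) (sym (Σℤ≡sum (λ i → f i * c))))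

Σℤ-zero : ∀ {m} {f : Vecℤ m} → (∀ i → f i ≡ + 0) → Σℤ f ≡ + 0
Σℤ-zero {m} e = trans (Σℤ-cong e) (trans (Σℤ≡sum {m} (λ _ → + 0)) (sum-replicate-zero m))

Σℤ-single : ∀ {m} (f : Vecℤ m) i → (∀ j → j ≢ i → f j ≡ + 0) → Σℤ f ≡ f i
Σℤ-single f zero off =
  trans (cong (_+_ (f zero)) (Σℤ-zero (λ j → off (suc j) λ ()))) (ℤP.+-identityʳ _)
Σℤ-single f (suc i) off =
  trans (cong₂ _+_ (off zero λ ())
                   (Σℤ-single (f ∘ suc) i (λ j j≢i → off (suc j) (j≢i ∘ FinP.suc-injective))))
        (ℤP.+-identityˡ _)

Σℤ-split : ∀ m {k} (f : Vecℤ (m ℕ.+ k)) →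
           Σℤ f ≡ Σℤ (f ∘ (_↑ˡ k)) + Σℤ (f ∘ (m ↑ʳ_))
Σℤ-split zero    f = sym (ℤP.+-identityˡ _)
Σℤ-split (suc m) f =
  trans (cong (_+_ (f zero)) (Σℤ-split m (f ∘ suc))) (sym (ℤP.+-assoc (f zero) _ _))

Σℤ-combine : ∀ n {m} (f : Vecℤ (n ℕ.* m)) → Σℤ f ≡ Σℤ (λ b → Σℤ (f ∘ combine {n} {m} b))
Σℤ-combine zero    f = refl
Σℤ-combine (suc n) {m} f =
  trans (Σℤ-split m f) (cong (_+_ (Σℤ (f ∘ (_↑ˡ n ℕ.* m)))) (Σℤ-combine n (f ∘ (m ↑ʳ_))))

·-congʳ : ∀ {r c} (M : Matℤ r c) {v w : Vecℤ c} → (∀ j → v j ≡ w j) →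
          ∀ i → (M · v) i ≡ (M · w) i
·-congʳ M e i = Σℤ-cong (λ j → cong (M i j *_) (e j))

↑-elim : ∀ {m k} {P : Fin (m ℕ.+ k) → Set} →
         (∀ i → P (i ↑ˡ k)) → (∀ r → P (m ↑ʳ r)) → ∀ x → P x
↑-elim {m} {k} {P} top bottom x = subst P (FinP.join-splitAt m k x) (on-sum (splitAt m x))
  where
  on-sum : ∀ y → P (join m k y)
  on-sum (inj₁ i) = top i
  on-sum (inj₂ r) = bottom r

combine-elim : ∀ {n m} {P : Fin (n ℕ.* m) → Set} → (∀ b i → P (combine b i)) → ∀ x → P x
combine-elim {n} {m} {P} h x =
  subst P (FinP.combine-remQuot {n} m x) (uncurry h (remQuot {n} m x))

δ-diag : ∀ {m} (i : Fin m) → δ i i ≡ + 1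
δ-diag i with i ≟ i
... | yes _   = refl
... | no  i≢i = ⊥-elim (i≢i refl)

δ-off : ∀ {m} {i j : Fin m} → i ≢ j → δ i j ≡ + 0
δ-off {i = i} {j} i≢j with i ≟ j
... | yes i≡j = ⊥-elim (i≢j i≡j)
... | no  _   = refl

δ-comm : ∀ {m} (i j : Fin m) → δ i j ≡ δ j i
δ-comm i j with i ≟ j | j ≟ i
... | yes _   | yes _   = refl
... | no  _   | no  _   = refl
... | yes i≡j | no  j≢i = ⊥-elim (j≢i (sym i≡j))
... | no  i≢j | yes j≡i = ⊥-elim (i≢j (sym j≡i))

Σℤ-neg-δ : ∀ {m} (i : Fin m) (v : Vecℤ m) → Σℤ (λ j → - δ i j * v j) ≡ - v i
Σℤ-neg-δ i v = begin
  Σℤ (λ j → - δ i j * v j)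
    ≡⟨ Σℤ-single _ i (λ j j≢i → cong (λ d → - d * v j) (δ-off (j≢i ∘ sym))) ⟩
  - δ i i * v i            ≡⟨ cong (λ d → - d * v i) (δ-diag i) ⟩
  - + 1 * v i              ≡⟨ ℤP.-1*i≡-i (v i) ⟩
  - v i                    ∎

module _ (m : ℕ) where

  Am-top-zero : ∀ i → Am (suc m) (i ↑ˡ s m) zero ≡ + 1
  Am-top-zero i rewrite FinP.splitAt-↑ˡ m i (s m) = refl

  Am-top-suc : ∀ i j → Am (suc m) (i ↑ˡ s m) (suc j) ≡ - δ i j
  Am-top-suc i j rewrite FinP.splitAt-↑ˡ m i (s m) = refl

  Am-bottom-zero : ∀ r → Am (suc m) (m ↑ʳ r) zero ≡ + 0
  Am-bottom-zero r rewrite FinP.splitAt-↑ʳ m (s m) r = refl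

  Am-bottom-suc : ∀ r j → Am (suc m) (m ↑ʳ r) (suc j) ≡ Am m r j
  Am-bottom-suc r j rewrite FinP.splitAt-↑ʳ m (s m) r = refl

  Am·-top : ∀ (z : Vecℤ (suc m)) i → (Am (suc m) · z) (i ↑ˡ s m) ≡ z zero - z (suc i)
  Am·-top z i = begin
    (Am (suc m) · z) (i ↑ˡ s m)
      ≡⟨ cong₂ _+_ (cong (_* z zero) (Am-top-zero i))
                   (Σℤ-cong λ j → cong (_* z (suc j)) (Am-top-suc i j)) ⟩
    + 1 * z zero + Σℤ (λ j → - δ i j * z (suc j))
      ≡⟨ cong₂ _+_ (ℤP.*-identityˡ (z zero)) (Σℤ-neg-δ i (z ∘ suc)) ⟩
    z zero - z (suc i) ∎

  Am·-bottom : ∀ (z : Vecℤ (suc m)) r → (Am (suc m) · z) (m ↑ʳ r) ≡ (Am m · (z ∘ suc)) r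
  Am·-bottom z r = begin
    (Am (suc m) · z) (m ↑ʳ r)
      ≡⟨ cong₂ _+_ (cong (_* z zero) (Am-bottom-zero r))
                   (Σℤ-cong λ j → cong (_* z (suc j)) (Am-bottom-suc r j)) ⟩
    + 0 + (Am m · (z ∘ suc)) r
      ≡⟨ ℤP.+-identityˡ _ ⟩
    (Am m · (z ∘ suc)) r ∎

  Amᵀ·-zero : ∀ (μ : Vecℤ (s (suc m))) → ((Am (suc m) ᵀ) · μ) zero ≡ Σℤ (μ ∘ (_↑ˡ s m))
  Amᵀ·-zero μ = begin
    ((Am (suc m) ᵀ) · μ) zero
      ≡⟨ Σℤ-split m _ ⟩
    Σℤ (λ i → Am (suc m) (i ↑ˡ s m) zero * μ (i ↑ˡ s m))
      + Σℤ (λ r → Am (suc m) (m ↑ʳ r) zero * μ (m ↑ʳ r))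
      ≡⟨ cong₂ _+_ (Σℤ-cong λ i → trans (cong (_* μ (i ↑ˡ s m)) (Am-top-zero i)) (ℤP.*-identityˡ _))
                   (Σℤ-zero λ r → cong (_* μ (m ↑ʳ r)) (Am-bottom-zero r)) ⟩
    Σℤ (μ ∘ (_↑ˡ s m)) + + 0
      ≡⟨ ℤP.+-identityʳ _ ⟩
    Σℤ (μ ∘ (_↑ˡ s m)) ∎

  Amᵀ·-suc : ∀ (μ : Vecℤ (s (suc m))) j →
             ((Am (suc m) ᵀ) · μ) (suc j) ≡ - μ (j ↑ˡ s m) + ((Am m ᵀ) · (μ ∘ (m ↑ʳ_))) j
  Amᵀ·-suc μ j = begin
    ((Am (suc m) ᵀ) · μ) (suc j)
      ≡⟨ Σℤ-split m _ ⟩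
    Σℤ (λ i → Am (suc m) (i ↑ˡ s m) (suc j) * μ (i ↑ˡ s m))
      + Σℤ (λ r → Am (suc m) (m ↑ʳ r) (suc j) * μ (m ↑ʳ r))
      ≡⟨ cong₂ _+_ (Σℤ-cong λ i → cong (λ a → a * μ (i ↑ˡ s m))
                                       (trans (Am-top-suc i j) (cong -_ (δ-comm i j))))
                   (Σℤ-cong λ r → cong (_* μ (m ↑ʳ r)) (Am-bottom-suc r j)) ⟩
    Σℤ (λ i → - δ j i * μ (i ↑ˡ s m)) + ((Am m ᵀ) · (μ ∘ (m ↑ʳ_))) j
      ≡⟨ cong (_+ ((Am m ᵀ) · (μ ∘ (m ↑ʳ_))) j) (Σℤ-neg-δ j (μ ∘ (_↑ˡ s m))) ⟩
    - μ (j ↑ˡ s m) + ((Am m ᵀ) · (μ ∘ (m ↑ʳ_))) j ∎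

Am·-const : ∀ m (c : ℤ) r → (Am m · (λ _ → c)) r ≡ + 0
Am·-const (suc m) c = ↑-elim (λ i → trans (Am·-top m (λ _ → c) i) (ℤP.+-inverseʳ c))
                             (λ r → trans (Am·-bottom m (λ _ → c) r) (Am·-const m c r))

Am·<>0⇒injective : ∀ m (z : Vecℤ m) → (Am m · z) <>0 → Injective _≡_ _≡_ z
Am·<>0⇒injective (suc m) z Az<>0 {zero} {zero} _ = refl
Am·<>0⇒injective (suc m) z Az<>0 {zero} {suc k} z₀≡zₖ =
  ⊥-elim (Az<>0 (k ↑ˡ s m) (trans (Am·-top m z k)
                                  (trans (cong (_- z (suc k)) z₀≡zₖ) (ℤP.+-inverseʳ (z (suc k))))))
Am·<>0⇒injective (suc m) z Az<>0 {suc i} {zero} zᵢ≡z₀ =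
  ⊥-elim (Az<>0 (i ↑ˡ s m) (trans (Am·-top m z i)
                                  (trans (cong (_-_ (z zero)) zᵢ≡z₀) (ℤP.+-inverseʳ (z zero)))))
Am·<>0⇒injective (suc m) z Az<>0 {suc i} {suc k} zᵢ≡zₖ =
  cong suc (Am·<>0⇒injective m (z ∘ suc) (λ r → Az<>0 (m ↑ʳ r) ∘ trans (Am·-bottom m z r)) zᵢ≡zₖ)

sgnℤ-neg : ∀ a → - sgnℤ a ≡ sgnℤ (- a)
sgnℤ-neg (+ zero)  = refl
sgnℤ-neg (+ suc _) = refl
sgnℤ-neg -[1+ _ ]  = refl

sgnℤ-antisym : ∀ a b → - sgnℤ (a - b) ≡ sgnℤ (b - a)
sgnℤ-antisym a b = trans (sgnℤ-neg (a - b)) (cong sgnℤ (neg-sub a b))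
  where
  neg-sub : ∀ a b → - (a - b) ≡ b - a
  neg-sub = solve-∀

Signs : ∀ {m} → Vecℤ m → Set
Signs μ = ∀ i → μ i ≡ + 1 ⊎ μ i ≡ -[1+ 0 ]

sgn-signs : ∀ {m} {y : Vecℤ m} → y <>0 → Signs (sgn y)
sgn-signs {y = y} y<>0 i with y i | y<>0 i
... | + zero  | yᵢ≢0 = ⊥-elim (yᵢ≢0 refl)
... | + suc _ | _    = inj₁ refl
... | -[1+ _ ] | _   = inj₂ refl

1+a+[1+b]≡a+b+2 : ∀ a b → + 1 + a + (+ 1 + b) ≡ a + b + + 2
1+a+[1+b]≡a+b+2 = solve-∀

-1+a+[1+b]≡a+b : ∀ a b → -[1+ 0 ] + a + (+ 1 + b) ≡ a + b
-1+a+[1+b]≡a+b = solve-∀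

2*a+2≡2*[1+a] : ∀ a → + 2 * a + + 2 ≡ + 2 * (+ 1 + a)
2*a+2≡2*[1+a] = solve-∀

double≢0 : ∀ {a} → a ≢ + 0 → + 2 * a ≢ + 0
double≢0 a≢0 2a≡0 = [ (λ ()) , a≢0 ]′ (ℤP.i*j≡0⇒i≡0∨j≡0 (+ 2) 2a≡0)

double-<>0 : ∀ {m} {v w : Vecℤ m} → (∀ i → + 2 * v i ≡ w i) → v <>0 → w <>0
double-<>0 e v<>0 i wᵢ≡0 = double≢0 (v<>0 i) (trans (e i) wᵢ≡0)

halve-<>0 : ∀ {m} {v w : Vecℤ m} → (∀ i → + 2 * v i ≡ w i) → w <>0 → v <>0
halve-<>0 e w<>0 i vᵢ≡0 = w<>0 i (trans (sym (e i)) (cong (+ 2 *_) vᵢ≡0))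

-- Part (i) on a single block

Amᵀ-sgn-Am : ∀ m (z : Vecℤ m) j →
             ((Am m ᵀ) · sgn (Am m · z)) j ≡ Σℤ (λ k → sgnℤ (z j - z k))
Amᵀ-sgn-Am (suc m) z zero = begin
  ((Am (suc m) ᵀ) · sgn (Am (suc m) · z)) zero    ≡⟨ Amᵀ·-zero m _ ⟩
  Σℤ (λ i → sgnℤ ((Am (suc m) · z) (i ↑ˡ s m)))   ≡⟨ Σℤ-cong (λ i → cong sgnℤ (Am·-top m z i)) ⟩
  Σℤ (λ i → sgnℤ (z zero - z (suc i)))            ≡⟨ ℤP.+-identityˡ _ ⟨
  + 0 + Σℤ (λ i → sgnℤ (z zero - z (suc i)))
    ≡⟨ cong (λ d → sgnℤ d + Σℤ (λ i → sgnℤ (z zero - z (suc i)))) (ℤP.+-inverseʳ (z zero)) ⟨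
  Σℤ (λ k → sgnℤ (z zero - z k))                  ∎
Amᵀ-sgn-Am (suc m) z (suc j) = begin
  ((Am (suc m) ᵀ) · sgn (Am (suc m) · z)) (suc j)
    ≡⟨ Amᵀ·-suc m _ j ⟩
  - sgnℤ ((Am (suc m) · z) (j ↑ˡ s m)) + ((Am m ᵀ) · (sgn (Am (suc m) · z) ∘ (m ↑ʳ_))) j
    ≡⟨ cong₂ _+_ (cong (-_ ∘ sgnℤ) (Am·-top m z j))
                 (·-congʳ (Am m ᵀ) (cong sgnℤ ∘ Am·-bottom m z) j) ⟩
  - sgnℤ (z zero - z (suc j)) + ((Am m ᵀ) · sgn (Am m · (z ∘ suc))) j
    ≡⟨ cong₂ _+_ (sgnℤ-antisym (z zero) (z (suc j))) (Amᵀ-sgn-Am m (z ∘ suc) j) ⟩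
  Σℤ (λ k → sgnℤ (z (suc j) - z k)) ∎

Σℤ-sgn-below-zero : ∀ n → Σℤ {n} (λ v → sgnℤ (0 ⊖ suc (toℕ v))) ≡ - + n
Σℤ-sgn-below-zero zero    = refl
Σℤ-sgn-below-zero (suc n) = trans (cong (_+_ -[1+ 0 ]) (Σℤ-sgn-below-zero n)) (shift (+ n))
  where
  shift : ∀ N → -[1+ 0 ] + - N ≡ - (+ 1 + N)
  shift = solve-∀

Σℤ-sgn-below : ∀ n c → c ℕ.< n →
               Σℤ {n} (λ v → sgnℤ (c ⊖ toℕ v)) + + suc n ≡ + 2 * + suc c
Σℤ-sgn-below (suc n) zero _ =
  trans (cong (λ S → + 0 + S + + suc (suc n)) (Σℤ-sgn-below-zero n)) (0-b+[2+b]≡2*1 (+ n))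
  where
  0-b+[2+b]≡2*1 : ∀ b → + 0 + - b + (+ 2 + b) ≡ + 2 * + 1
  0-b+[2+b]≡2*1 = solve-∀
Σℤ-sgn-below (suc n) (suc c) (s≤s c<n) = begin
  + 1 + Σℤ {n} (λ v → sgnℤ (suc c ⊖ suc (toℕ v))) + + suc (suc n)
    ≡⟨ cong (λ S → + 1 + S + + suc (suc n))
            (Σℤ-cong {n} λ v → cong sgnℤ (ℤP.[1+m]⊖[1+n]≡m⊖n c (toℕ v))) ⟩
  + 1 + S + (+ 1 + + suc n)                 ≡⟨ 1+a+[1+b]≡a+b+2 S (+ suc n) ⟩
  S + + suc n + + 2                         ≡⟨ cong (_+ + 2) (Σℤ-sgn-below n c c<n) ⟩
  + 2 * + suc c + + 2                       ≡⟨ 2*a+2≡2*[1+a] (+ suc c) ⟩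
  + 2 * + suc (suc c)                       ∎
  where
  S : ℤ
  S = Σℤ {n} (λ v → sgnℤ (c ⊖ toℕ v))

in-range⇒suc-toℕ : ∀ n {a} → + 1 ≤ a → a ≤ + n → ∃ λ (v : Fin n) → a ≡ + suc (toℕ v)
in-range⇒suc-toℕ n {+ suc c} _ (+≤+ c<n) =
  Fin.fromℕ< c<n , cong (+_ ∘ suc) (sym (FinP.toℕ-fromℕ< c<n))
in-range⇒suc-toℕ n {+ zero}  (+≤+ ()) _
in-range⇒suc-toℕ n { -[1+ _ ]} () _

injective⇒surjective : ∀ {n} (f : Fin n → Fin n) → Injective _≡_ _≡_ f →
                       ∀ v → ∃ λ k → f k ≡ v
injective⇒surjective {suc n} f f-inj v with FinP.any? (λ k → f k ≟ v)
... | yes hit = hit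
... | no miss = ⊥-elim (ℕP.1+n≰n (FinP.injective⇒≤ f-avoiding-v-inj))
  where
  f-avoiding-v : Fin (suc n) → Fin n
  f-avoiding-v k = Fin.punchOut {i = v} {j = f k} (λ v≡fk → miss (k , sym v≡fk))
  f-avoiding-v-inj : Injective _≡_ _≡_ f-avoiding-v
  f-avoiding-v-inj {k} {k′} e = f-inj (FinP.punchOut-injective
    (λ v≡fk → miss (k , sym v≡fk)) (λ v≡fk′ → miss (k′ , sym v≡fk′)) e)

injective⇒permutation : ∀ {n} (f : Fin n → Fin n) → Injective _≡_ _≡_ f →
                        ∃ λ (π : Permutation′ n) → ∀ k → π ⟨$⟩ʳ k ≡ f k
injective⇒permutation f f-inj =
  permutation f (proj₁ ∘ onto) (proj₂ ∘ onto) (λ k → f-inj (proj₂ (onto (f k)))) , λ _ → refl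
  where
  onto : ∀ v → ∃ λ k → f k ≡ v
  onto = injective⇒surjective f f-inj

Σℤ-sgn-distinct : ∀ n (z : Vecℤ n) → (∀ i → (+ 1 ≤ z i) × (z i ≤ + n)) →
                  Injective _≡_ _≡_ z → ∀ j → + 2 * z j ≡ Σℤ (λ k → sgnℤ (z j - z k)) + + suc n
Σℤ-sgn-distinct n z range z-inj j = begin
  + 2 * z j
    ≡⟨ cong (+ 2 *_) (z≡ j) ⟩
  + 2 * + suc (toℕ (f j))
    ≡⟨ Σℤ-sgn-below n (toℕ (f j)) (FinP.toℕ<n (f j)) ⟨
  Σℤ {n} (λ v → sgnℤ (toℕ (f j) ⊖ toℕ v)) + + suc n
    ≡⟨ cong (_+ + suc n) (Σℤ-permute _ π) ⟨
  Σℤ {n} (λ k → sgnℤ (toℕ (f j) ⊖ toℕ (π ⟨$⟩ʳ k))) + + suc n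
    ≡⟨ cong (_+ + suc n) (Σℤ-cong (λ k → cong sgnℤ (sym (sub-via-f k)))) ⟩
  Σℤ (λ k → sgnℤ (z j - z k)) + + suc n
    ∎
  where
  f : Fin n → Fin n
  f i = proj₁ (in-range⇒suc-toℕ n (proj₁ (range i)) (proj₂ (range i)))
  z≡ : ∀ i → z i ≡ + suc (toℕ (f i))
  z≡ i = proj₂ (in-range⇒suc-toℕ n (proj₁ (range i)) (proj₂ (range i)))
  f-inj : Injective _≡_ _≡_ f
  f-inj e = z-inj (trans (z≡ _) (trans (cong (+_ ∘ suc ∘ toℕ) e) (sym (z≡ _))))
  π : Permutation′ n
  π = proj₁ (injective⇒permutation f f-inj)
  π≗f : ∀ k → π ⟨$⟩ʳ k ≡ f k
  π≗f = proj₂ (injective⇒permutation f f-inj)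
  sub-via-f : ∀ k → z j - z k ≡ toℕ (f j) ⊖ toℕ (π ⟨$⟩ʳ k)
  sub-via-f k = begin
    z j - z k                                    ≡⟨ cong₂ _-_ (z≡ j) (z≡ k) ⟩
    + suc (toℕ (f j)) - + suc (toℕ (f k))        ≡⟨ ℤP.[1+m]⊖[1+n]≡m⊖n (toℕ (f j)) (toℕ (f k)) ⟩
    toℕ (f j) ⊖ toℕ (f k)                        ≡⟨ cong ((toℕ (f j) ⊖_) ∘ toℕ) (π≗f k) ⟨
    toℕ (f j) ⊖ toℕ (π ⟨$⟩ʳ k)                   ∎

-- Part (ii) on a single block

Σℤ-signs : ∀ {m} (μ : Vecℤ m) → Signs μ → ∃ λ t → t ℕ.≤ m × Σℤ μ + + m ≡ + 2 * + t
Σℤ-signs {zero} μ _ = 0 , z≤n , refl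
Σℤ-signs {suc m} μ signs with Σℤ-signs (μ ∘ suc) (signs ∘ suc) | signs zero
... | t , t≤m , e | inj₁ μ₀≡1 = suc t , s≤s t≤m , (begin
  μ zero + S + + suc m         ≡⟨ cong (λ a → a + S + + suc m) μ₀≡1 ⟩
  + 1 + S + (+ 1 + + m)        ≡⟨ 1+a+[1+b]≡a+b+2 S (+ m) ⟩
  S + + m + + 2                ≡⟨ cong (_+ + 2) e ⟩
  + 2 * + t + + 2              ≡⟨ 2*a+2≡2*[1+a] (+ t) ⟩
  + 2 * + suc t                ∎)
  where
  S : ℤ
  S = Σℤ (μ ∘ suc)
... | t , t≤m , e | inj₂ μ₀≡-1 = t , ℕP.m≤n⇒m≤1+n t≤m , (begin
  μ zero + S + + suc m         ≡⟨ cong (λ a → a + S + + suc m) μ₀≡-1 ⟩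
  -[1+ 0 ] + S + (+ 1 + + m)   ≡⟨ -1+a+[1+b]≡a+b S (+ m) ⟩
  S + + m                      ≡⟨ e ⟩
  + 2 * + t                    ∎)
  where
  S : ℤ
  S = Σℤ (μ ∘ suc)

Amᵀ·-signs : ∀ m (μ : Vecℤ (s m)) → Signs μ → ∀ j →
             ∃ λ t → t ℕ.< m × ((Am m ᵀ) · μ) j + + suc m ≡ + 2 * + suc t
Amᵀ·-signs (suc m) μ signs zero with Σℤ-signs (μ ∘ (_↑ˡ s m)) (signs ∘ (_↑ˡ s m))
... | t , t≤m , e = t , s≤s t≤m , (begin
  ((Am (suc m) ᵀ) · μ) zero + + suc (suc m)   ≡⟨ cong (_+ + suc (suc m)) (Amᵀ·-zero m μ) ⟩
  S + (+ 2 + + m)                            ≡⟨ a+[2+b]≡a+b+2 S (+ m) ⟩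
  S + + m + + 2                              ≡⟨ cong (_+ + 2) e ⟩
  + 2 * + t + + 2                            ≡⟨ 2*a+2≡2*[1+a] (+ t) ⟩
  + 2 * + suc t                              ∎)
  where
  S : ℤ
  S = Σℤ (μ ∘ (_↑ˡ s m))
  a+[2+b]≡a+b+2 : ∀ a b → a + (+ 2 + b) ≡ a + b + + 2
  a+[2+b]≡a+b+2 = solve-∀
Amᵀ·-signs (suc m) μ signs (suc j)
  with Amᵀ·-signs m (μ ∘ (m ↑ʳ_)) (signs ∘ (m ↑ʳ_)) j | signs (j ↑ˡ s m)
... | t , t<m , e | inj₁ μⱼ≡1 = t , ℕP.m≤n⇒m≤1+n t<m , (begin
  ((Am (suc m) ᵀ) · μ) (suc j) + + suc (suc m)   ≡⟨ cong (_+ + suc (suc m)) (Amᵀ·-suc m μ j) ⟩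
  - μ (j ↑ˡ s m) + C + (+ 1 + + suc m)          ≡⟨ cong (λ a → - a + C + (+ 1 + + suc m)) μⱼ≡1 ⟩
  -[1+ 0 ] + C + (+ 1 + + suc m)                ≡⟨ -1+a+[1+b]≡a+b C (+ suc m) ⟩
  C + + suc m                                   ≡⟨ e ⟩
  + 2 * + suc t                                 ∎)
  where
  C : ℤ
  C = ((Am m ᵀ) · (μ ∘ (m ↑ʳ_))) j
... | t , t<m , e | inj₂ μⱼ≡-1 = suc t , s≤s t<m , (begin
  ((Am (suc m) ᵀ) · μ) (suc j) + + suc (suc m)   ≡⟨ cong (_+ + suc (suc m)) (Amᵀ·-suc m μ j) ⟩
  - μ (j ↑ˡ s m) + C + (+ 1 + + suc m)          ≡⟨ cong (λ a → - a + C + (+ 1 + + suc m)) μⱼ≡-1 ⟩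
  + 1 + C + (+ 1 + + suc m)                     ≡⟨ 1+a+[1+b]≡a+b+2 C (+ suc m) ⟩
  C + + suc m + + 2                             ≡⟨ cong (_+ + 2) e ⟩
  + 2 * + suc t + + 2                           ≡⟨ 2*a+2≡2*[1+a] (+ suc t) ⟩
  + 2 * + suc (suc t)                           ∎)
  where
  C : ℤ
  C = ((Am m ᵀ) · (μ ∘ (m ↑ʳ_))) j

-- The block-diagonal matrix A and its column permutations A_π

quotRem-combine : ∀ {n} k (b : Fin n) (i : Fin k) → quotRem {n} k (combine b i) ≡ (i , b)
quotRem-combine k b i = cong swap (FinP.remQuot-combine b i)

blockA-diag : ∀ n (b : Fin n) i j → blockA n (combine b i) (combine b j) ≡ Am n i j
blockA-diag n b i j rewrite quotRem-combine (s n) b i | quotRem-combine n b j with b ≟ b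
... | yes _   = refl
... | no  b≢b = ⊥-elim (b≢b refl)

blockA-off : ∀ n {b b′ : Fin n} i j → b ≢ b′ → blockA n (combine b i) (combine b′ j) ≡ + 0
blockA-off n {b} {b′} i j b≢b′
  rewrite quotRem-combine (s n) b i | quotRem-combine n b′ j with b ≟ b′
... | yes b≡b′ = ⊥-elim (b≢b′ b≡b′)
... | no  _    = refl

blockA·-combine : ∀ n (y : Vecℤ (n ℕ.* n)) b i →
                  (blockA n · y) (combine b i) ≡ (Am n · (y ∘ combine b)) i
blockA·-combine n y b i = begin
  (blockA n · y) (combine b i)
    ≡⟨ Σℤ-combine n {n} (λ c → blockA n (combine b i) c * y c) ⟩
  Σℤ {n} (λ b′ → Σℤ {n} (λ j → blockA n (combine b i) (combine b′ j) * y (combine b′ j)))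
    ≡⟨ Σℤ-single _ b (λ b′ b′≢b → Σℤ-zero λ j →
         cong (_* y (combine b′ j)) (blockA-off n i j (b′≢b ∘ sym))) ⟩
  Σℤ {n} (λ j → blockA n (combine b i) (combine b j) * y (combine b j))
    ≡⟨ Σℤ-cong (λ j → cong (_* y (combine b j)) (blockA-diag n b i j)) ⟩
  (Am n · (y ∘ combine b)) i ∎

blockAᵀ·-combine : ∀ n (μ : Vecℤ (n ℕ.* s n)) b j →
                   ((blockA n ᵀ) · μ) (combine b j) ≡ ((Am n ᵀ) · (μ ∘ combine b)) j
blockAᵀ·-combine n μ b j = begin
  ((blockA n ᵀ) · μ) (combine b j)
    ≡⟨ Σℤ-combine n {s n} (λ r → blockA n r (combine b j) * μ r) ⟩
  Σℤ {n} (λ b′ → Σℤ {s n} (λ i → blockA n (combine b′ i) (combine b j) * μ (combine b′ i)))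
    ≡⟨ Σℤ-single _ b (λ b′ b′≢b → Σℤ-zero λ i →
         cong (_* μ (combine b′ i)) (blockA-off n i j b′≢b)) ⟩
  Σℤ {s n} (λ i → blockA n (combine b i) (combine b j) * μ (combine b i))
    ≡⟨ Σℤ-cong (λ i → cong (_* μ (combine b i)) (blockA-diag n b i j)) ⟩
  ((Am n ᵀ) · (μ ∘ combine b)) j ∎

blockA-rowSum : ∀ n r → Σℤ (blockA n r) ≡ + 0
blockA-rowSum n = combine-elim λ b i → begin
  Σℤ (blockA n (combine b i))
    ≡⟨ Σℤ-cong (λ c → ℤP.*-identityʳ (blockA n (combine b i) c)) ⟨
  (blockA n · (λ _ → + 1)) (combine b i)       ≡⟨ blockA·-combine n (λ _ → + 1) b i ⟩
  (Am n · (λ _ → + 1)) i                       ≡⟨ Am·-const n (+ 1) i ⟩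
  + 0                                          ∎

Aπ-rowSum : ∀ n π r → Σℤ (Aπ n π r) ≡ + 0
Aπ-rowSum n π r = trans (Σℤ-permute (blockA n r) (flip π)) (blockA-rowSum n r)

Aπ·≡blockA· : ∀ n π (x : Vecℤ (n ℕ.* n)) r → (Aπ n π · x) r ≡ (blockA n · (x ∘ (π ⟨$⟩ʳ_))) r
Aπ·≡blockA· n π x r = begin
  (Aπ n π · x) r
    ≡⟨ Σℤ-permute (λ j → blockA n r (π ⟨$⟩ˡ j) * x j) π ⟨
  Σℤ (λ c → blockA n r (π ⟨$⟩ˡ (π ⟨$⟩ʳ c)) * x (π ⟨$⟩ʳ c))
    ≡⟨ Σℤ-cong (λ c → cong (λ c′ → blockA n r c′ * x (π ⟨$⟩ʳ c)) (inverseˡ π)) ⟩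
  (blockA n · (x ∘ (π ⟨$⟩ʳ_))) r ∎

blockAᵀ-sgn-blockA : ∀ n (y : Vecℤ (n ℕ.* n)) → (∀ c → (+ 1 ≤ y c) × (y c ≤ + n)) →
                     (blockA n · y) <>0 →
                     ∀ c → + 2 * y c ≡ ((blockA n ᵀ) · sgn (blockA n · y)) c + + suc n
blockAᵀ-sgn-blockA n y range Ay<>0 = combine-elim λ b j → begin
  + 2 * y (combine b j)
    ≡⟨ Σℤ-sgn-distinct n (y ∘ combine b) (range ∘ combine b) (block-injective b) j ⟩
  Σℤ (λ k → sgnℤ (y (combine b j) - y (combine b k))) + + suc n
    ≡⟨ cong (_+ + suc n) (Amᵀ-sgn-Am n (y ∘ combine b) j) ⟨
  ((Am n ᵀ) · sgn (Am n · (y ∘ combine b))) j + + suc n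
    ≡⟨ cong (_+ + suc n) (·-congʳ (Am n ᵀ) (cong sgnℤ ∘ blockA·-combine n y b) j) ⟨
  ((Am n ᵀ) · (sgn (blockA n · y) ∘ combine b)) j + + suc n
    ≡⟨ cong (_+ + suc n) (blockAᵀ·-combine n _ b j) ⟨
  ((blockA n ᵀ) · sgn (blockA n · y)) (combine b j) + + suc n ∎
  where
  block-injective : ∀ b → Injective _≡_ _≡_ (y ∘ combine b)
  block-injective b =
    Am·<>0⇒injective n (y ∘ combine b) (λ i → Ay<>0 (combine b i) ∘ trans (blockA·-combine n y b i))

Aπᵀ-sgn-Aπ : ∀ n π (x : Vecℤ (n ℕ.* n)) → (∀ j → (+ 1 ≤ x j) × (x j ≤ + n)) →
             (Aπ n π · x) <>0 →
             ∀ j → + 2 * x j ≡ ((Aπ n π ᵀ) · sgn (Aπ n π · x)) j + + suc n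
Aπᵀ-sgn-Aπ n π x range Ax<>0 j = begin
  + 2 * x j
    ≡⟨ cong (λ j′ → + 2 * x j′) (inverseʳ π) ⟨
  + 2 * y (π ⟨$⟩ˡ j)
    ≡⟨ blockAᵀ-sgn-blockA n y (range ∘ (π ⟨$⟩ʳ_)) Ay<>0 (π ⟨$⟩ˡ j) ⟩
  ((blockA n ᵀ) · sgn (blockA n · y)) (π ⟨$⟩ˡ j) + + suc n
    ≡⟨ cong (_+ + suc n) (·-congʳ (blockA n ᵀ) (cong sgnℤ ∘ Aπ·≡blockA· n π x) (π ⟨$⟩ˡ j)) ⟨
  ((Aπ n π ᵀ) · sgn (Aπ n π · x)) j + + suc n ∎
  where
  y : Vecℤ (n ℕ.* n)
  y = x ∘ (π ⟨$⟩ʳ_)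
  Ay<>0 : (blockA n · y) <>0
  Ay<>0 r = Ax<>0 r ∘ trans (Aπ·≡blockA· n π x r)

blockAᵀ·-signs : ∀ n (μ : Vecℤ (n ℕ.* s n)) → Signs μ →
                 ∀ c → ∃ λ t → t ℕ.< n × ((blockA n ᵀ) · μ) c + + suc n ≡ + 2 * + suc t
blockAᵀ·-signs n μ signs = combine-elim λ b j →
  let t , t<n , e = Amᵀ·-signs n (μ ∘ combine b) (signs ∘ combine b) j
  in  t , t<n , trans (cong (_+ + suc n) (blockAᵀ·-combine n μ b j)) e

-- Passing between x and u = A_{π₁}ᵀ λ with 2x = u + (n+1)𝟏

zeroRowSums⇒2[M·x]≡M·u : ∀ {r c} (M : Matℤ r c) → (∀ i → Σℤ (M i) ≡ + 0) →
                         {x u : Vecℤ c} {k : ℤ} → (∀ j → + 2 * x j ≡ u j + k) →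
                         ∀ i → + 2 * (M · x) i ≡ (M · u) i
zeroRowSums⇒2[M·x]≡M·u M rowSum {x} {u} {k} half i = begin
  + 2 * (M · x) i                       ≡⟨ ℤP.*-comm (+ 2) _ ⟩
  (M · x) i * + 2                       ≡⟨ Σℤ-distribʳ-* (λ j → M i j * x j) (+ 2) ⟩
  Σℤ (λ j → M i j * x j * + 2)          ≡⟨ Σℤ-cong (λ j → trans (a*b*2≡a*[2*b] (M i j) (x j))
                                                                (cong (M i j *_) (half j))) ⟩
  Σℤ (λ j → M i j * (u j + k))          ≡⟨ Σℤ-cong (λ j → ℤP.*-distribˡ-+ (M i j) (u j) k) ⟩
  Σℤ (λ j → M i j * u j + M i j * k)    ≡⟨ Σℤ-distrib-+ (λ j → M i j * u j) (λ j → M i j * k) ⟩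
  (M · u) i + Σℤ (λ j → M i j * k)      ≡⟨ cong (_+_ ((M · u) i)) (Σℤ-distribʳ-* (M i) k) ⟨
  (M · u) i + Σℤ (M i) * k              ≡⟨ cong (λ S → (M · u) i + S * k) (rowSum i) ⟩
  (M · u) i + + 0                       ≡⟨ ℤP.+-identityʳ _ ⟩
  (M · u) i                             ∎
  where
  a*b*2≡a*[2*b] : ∀ a b → a * b * + 2 ≡ a * (+ 2 * b)
  a*b*2≡a*[2*b] = solve-∀

x≡g⇒u≡2g-N : ∀ {x u g N} → + 2 * x ≡ u + N → x ≡ g → u ≡ + 2 * g - N
x≡g⇒u≡2g-N {u = u} {N = N} 2x≡u+N refl = trans (a≡a+b-b u N) (cong (_- N) (sym 2x≡u+N))
  where
  a≡a+b-b : ∀ a b → a ≡ a + b - b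
  a≡a+b-b = solve-∀

u≡2g-N⇒x≡g : ∀ {x u g N} → + 2 * x ≡ u + N → u ≡ + 2 * g - N → x ≡ g
u≡2g-N⇒x≡g {x} {u} {g} {N} 2x≡u+N u≡2g-N =
  ℤP.*-cancelˡ-≡ (+ 2) x g (trans 2x≡u+N (trans (cong (_+ N) u≡2g-N) (a-b+b≡a (+ 2 * g) N)))
  where
  a-b+b≡a : ∀ a b → a - b + b ≡ a
  a-b+b≡a = solve-∀

theorem3p1 : (n : ℕ) → n ≥ 2 → (π₁ π₂ π₃ : Permutation′ (n ℕ.* n)) →
    (k : ℕ) → (ι : Fin k → Fin (n ℕ.* n)) → Injective _≡_ _≡_ ι →
    (g : Vecℤ k) → (∀ l → (+ 1 ≤ g l) × (g l ≤ + n)) →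
    ((x : Vecℤ (n ℕ.* n)) → PP n π₁ π₂ π₃ k ι g x →
       DP n π₁ π₂ π₃ k ι g (sgn (Aπ n π₁ · x)))
    ×
    ((lam : Vecℤ (n ℕ.* s n)) → DP n π₁ π₂ π₃ k ι g lam →
       ∃ λ (x : Vecℤ (n ℕ.* n)) →
         (∀ i → + 2 * x i ≡ ((Aπ n π₁ ᵀ) · lam) i + + (suc n)) ×
         PP n π₁ π₂ π₃ k ι g x)
theorem3p1 n _ π₁ π₂ π₃ k ι _ g _ = primal⇒dual , dual⇒primal
  where
  doubled : ∀ {x} lam → (∀ j → + 2 * x j ≡ ((Aπ n π₁ ᵀ) · lam) j + + suc n) →
            ∀ π i → + 2 * (Aπ n π · x) i ≡ (Aπ n π · ((Aπ n π₁ ᵀ) · lam)) i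
  doubled lam half π = zeroRowSums⇒2[M·x]≡M·u (Aπ n π) (Aπ-rowSum n π) half

  primal⇒dual : (x : Vecℤ (n ℕ.* n)) → PP n π₁ π₂ π₃ k ι g x →
                DP n π₁ π₂ π₃ k ι g (sgn (Aπ n π₁ · x))
  primal⇒dual x (range , A₁x<>0 , A₂x<>0 , A₃x<>0 , fixed) =
    sgn-signs A₁x<>0 ,
    double-<>0 (doubled lam half π₁) A₁x<>0 ,
    double-<>0 (doubled lam half π₂) A₂x<>0 ,
    double-<>0 (doubled lam half π₃) A₃x<>0 ,
    λ l → x≡g⇒u≡2g-N (half (ι l)) (fixed l)
    where
    lam : Vecℤ (n ℕ.* s n)
    lam = sgn (Aπ n π₁ · x)
    half : ∀ j → + 2 * x j ≡ ((Aπ n π₁ ᵀ) · lam) j + + suc n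
    half = Aπᵀ-sgn-Aπ n π₁ x range A₁x<>0

  dual⇒primal : (lam : Vecℤ (n ℕ.* s n)) → DP n π₁ π₂ π₃ k ι g lam →
                ∃ λ (x : Vecℤ (n ℕ.* n)) →
                  (∀ i → + 2 * x i ≡ ((Aπ n π₁ ᵀ) · lam) i + + (suc n)) ×
                  PP n π₁ π₂ π₃ k ι g x
  dual⇒primal lam (signs , A₁u<>0 , A₂u<>0 , A₃u<>0 , fixed) =
    x , half ,
    range ,
    halve-<>0 (doubled lam half π₁) A₁u<>0 ,
    halve-<>0 (doubled lam half π₂) A₂u<>0 ,
    halve-<>0 (doubled lam half π₃) A₃u<>0 ,
    λ l → u≡2g-N⇒x≡g (half (ι l)) (fixed l)
    where
    column : ∀ j → ∃ λ t → t ℕ.< n × ((Aπ n π₁ ᵀ) · lam) j + + suc n ≡ + 2 * + suc t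
    column j = blockAᵀ·-signs n lam signs (π₁ ⟨$⟩ˡ j)
    x : Vecℤ (n ℕ.* n)
    x j = + suc (proj₁ (column j))
    half : ∀ j → + 2 * x j ≡ ((Aπ n π₁ ᵀ) · lam) j + + suc n
    half j = sym (proj₂ (proj₂ (column j)))
    range : ∀ j → (+ 1 ≤ x j) × (x j ≤ + n)
    range j = +≤+ (s≤s z≤n) , +≤+ (proj₁ (proj₂ (column j)))
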